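{- Let $k \in \mathbb{Z}_+$ and let $\mathcal{H}$ be a $k$-uniform hypergraph. If Maker wins the $(k,1)$-game on $\mathcal{H}$, then $|E(\mathcal{H})| \geq \left\lfloor \frac{k}{2}\right\rfloor + 1$.
   Context: A hypergraph $\mathcal{H}$ consists of a finite vertex set $V(\mathcal{H})$ and a set $E(\mathcal{H})$ of subsets of $V(\mathcal{H})$ (edges); it is $k$-uniform if every edge has exactly $k$ vertices. The $(a,b)$-game on $\mathcal{H}$: Maker has $a$ tokens and Breaker has $b$ tokens; initially the board is empty. Players alternate turns, Maker first. On a turn a player may pass, or place one of their own tokens on an unoccupied vertex, the token being either not yet used or moved from its current vertex on the board (which becomes unoccupied). Maker wins as soon as all vertices of some edge carry Maker tokens; Breaker wins if this never happens or if the game reaches the same state twice. "Maker wins" means Maker has a winning strategy. -}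

module Defs where

open import Data.Nat using (ℕ; _<_)
open import Data.Bool using (Bool; true; false)
open import Data.Fin using (Fin)
open import Data.Fin.Subset using (Subset; _∈_; _∉_; _⊆_; _∪_; _-_; ⁅_⁆; ∣_∣; ⊥)
open import Data.List using (List; []; _∷_)
open import Data.List.Relation.Unary.Any using (Any)
open import Data.Product using (Σ; ∃; _×_)
open import Relation.Binary.PropositionalEquality using (_≡_)
open import Relation.Nullary using (¬_)

-- A hypergraph on vertex set Fin n is given by its list of edges
-- (each edge a subset of Fin n); distinctness of edges is imposed
-- separately (Unique) in the statement, so |E(H)| = length of the list.

Uniform : ∀ {n} → ℕ → List (Subset n) → Set
Uniform k E = ∀ e → Any (e ≡_) E → ∣ e ∣ ≡ k

-- Tokens of one player are indistinguishable; the number of unused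
-- tokens of a player is (#tokens) minus (#own tokens on the board).
record State (n : ℕ) : Set where
  constructor st
  field
    maker   : Subset n
    breaker : Subset n
    makerToMove : Bool

open State public

data Step {n : ℕ} (c : ℕ) (S T : Subset n) : Subset n → Set where
  pass  : Step c S T S
  place : ∀ v → ∣ S ∣ < c → v ∉ S → v ∉ T → Step c S T (S ∪ ⁅ v ⁆)
  move  : ∀ u v → u ∈ S → v ∉ S → v ∉ T → Step c S T ((S - u) ∪ ⁅ v ⁆)

data Move {n : ℕ} (a b : ℕ) : State n → State n → Set where
  makerMove   : ∀ {M M' B} → Step a M B M' → Move a b (st M B true) (st M' B false)
  breakerMove : ∀ {M B B'} → Step b B M B' → Move a b (st M B false) (st M B' true)

MakerDone : ∀ {n} → List (Subset n) → State n → Set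
MakerDone E s = Any (λ e → e ⊆ maker s) E

_∈ₗ_ : ∀ {n} → State n → List (State n) → Set
s ∈ₗ h = Any (s ≡_) h

-- Reaching a state already in the play (h or the current
-- one) is a Breaker win. Inductive, so Maker wins in finitely many moves
-- (the game is finite anyway by the repetition rule).
data MakerWinsFrom {n : ℕ} (a b : ℕ) (E : List (Subset n))
       (h : List (State n)) : State n → Set where
  done : ∀ {s} → MakerDone E s → MakerWinsFrom a b E h s
  makerTurn : ∀ {M B} → let s = st M B true in
    ¬ MakerDone E s →
    (s' : State n) → Move a b s s' → ¬ (s' ∈ₗ (s ∷ h)) →
    MakerWinsFrom a b E (s ∷ h) s' → MakerWinsFrom a b E h s
  breakerTurn : ∀ {M B} → let s = st M B false in
    ¬ MakerDone E s →
    (∀ s' → Move a b s s' →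
       (¬ (s' ∈ₗ (s ∷ h))) × MakerWinsFrom a b E (s ∷ h) s') →
    MakerWinsFrom a b E h s

MakerWins : ∀ {n} → ℕ → ℕ → List (Subset n) → Set
MakerWins a b E = MakerWinsFrom a b E [] (st ⊥ ⊥ true)

module Submission where

-- For a set F of edges let C F be its core, the set of vertices common to all of them. Against a
-- single Breaker token Maker can only win by forcing an admissible F: a single edge, or the union of
-- two admissible families whose cores together span at most k + 2 vertices (two threats Breaker
-- cannot both block). From the empty board Maker is at most one vertex away from such a core, so
-- |C F| ≤ 1. On the other hand, adjoining the edges of an admissible F to any family meeting F costs
-- the core at most two vertices per new edge; starting from one k-edge of F this gives
-- k + 2 ≤ |C F| + 2|F|, hence k < 2|F| ≤ 2|E(H)|.

open import Defs
open import Data.Nat using (ℕ; zero; suc; _+_; _*_; _≤_; _<_; z≤n; s≤s; ⌊_/2⌋)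
open import Data.Nat.Properties
  using (≤-trans; ≤-reflexive; ≤-pred; +-suc; +-comm; +-mono-≤; +-monoˡ-≤; +-monoʳ-≤;
         +-cancelʳ-≤; *-monoʳ-≤; *-distribˡ-+; n≤0⇒n≡0; module ≤-Reasoning)
open import Data.Nat.Tactic.RingSolver using (solve-∀)
open import Data.Fin using (Fin; zero; suc)
open import Data.Fin.Subset
open import Data.Fin.Subset.Properties
open import Data.Bool using (true; false)
open import Data.Vec using ([]; _∷_; here; there)
open import Data.List using (List; []; _∷_; length; lookup)
open import Data.List.Membership.Propositional.Properties using (∈-lookup)
open import Data.List.Relation.Unary.Any using (Any; index)
open import Data.List.Relation.Unary.Any.Properties using (lookup-index)
open import Data.List.Relation.Unary.Unique.Propositional using (Unique)
open import Data.Product using (∃-syntax; _×_; _,_; proj₁; proj₂)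
open import Data.Sum using (_⊎_; inj₁; inj₂; [_,_])
open import Relation.Nullary using (yes; no; contradiction)
open import Relation.Binary.PropositionalEquality using (_≡_; _≢_; refl; sym; trans; cong; subst)

∣p─q∣+∣q∣≡∣p∪q∣ : ∀ {n} (p q : Subset n) → ∣ p ─ q ∣ + ∣ q ∣ ≡ ∣ p ∪ q ∣
∣p─q∣+∣q∣≡∣p∪q∣ []            []            = refl
∣p─q∣+∣q∣≡∣p∪q∣ (inside  ∷ p) (inside  ∷ q) = trans (+-suc _ _) (cong suc (∣p─q∣+∣q∣≡∣p∪q∣ p q))
∣p─q∣+∣q∣≡∣p∪q∣ (outside ∷ p) (inside  ∷ q) = trans (+-suc _ _) (cong suc (∣p─q∣+∣q∣≡∣p∪q∣ p q))
∣p─q∣+∣q∣≡∣p∪q∣ (inside  ∷ p) (outside ∷ q) = cong suc (∣p─q∣+∣q∣≡∣p∪q∣ p q)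
∣p─q∣+∣q∣≡∣p∪q∣ (outside ∷ p) (outside ∷ q) = ∣p─q∣+∣q∣≡∣p∪q∣ p q

∣p─r∣+∣q─r∪p∣≡∣p∪q─r∣ : ∀ {n} (p q r : Subset n) →
  ∣ p ─ r ∣ + ∣ q ─ (r ∪ p) ∣ ≡ ∣ (p ∪ q) ─ r ∣
∣p─r∣+∣q─r∪p∣≡∣p∪q─r∣ []            []            []            = refl
∣p─r∣+∣q─r∪p∣≡∣p∪q─r∣ (_       ∷ p) (_       ∷ q) (inside  ∷ r) = ∣p─r∣+∣q─r∪p∣≡∣p∪q─r∣ p q r
∣p─r∣+∣q─r∪p∣≡∣p∪q─r∣ (inside  ∷ p) (_       ∷ q) (outside ∷ r) = cong suc (∣p─r∣+∣q─r∪p∣≡∣p∪q─r∣ p q r)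
∣p─r∣+∣q─r∪p∣≡∣p∪q─r∣ (outside ∷ p) (inside  ∷ q) (outside ∷ r) =
  trans (+-suc _ _) (cong suc (∣p─r∣+∣q─r∪p∣≡∣p∪q─r∣ p q r))
∣p─r∣+∣q─r∪p∣≡∣p∪q─r∣ (outside ∷ p) (outside ∷ q) (outside ∷ r) = ∣p─r∣+∣q─r∪p∣≡∣p∪q─r∣ p q r

∣p∪q∣≤∣p∣+∣q∣ : ∀ {n} (p q : Subset n) → ∣ p ∪ q ∣ ≤ ∣ p ∣ + ∣ q ∣
∣p∪q∣≤∣p∣+∣q∣ p q = ≤-trans (≤-reflexive (sym (∣p─q∣+∣q∣≡∣p∪q∣ p q))) (+-monoˡ-≤ ∣ q ∣ (∣p─q∣≤∣p∣ p q))

∣p∪⁅x⁆∣≤suc∣p∣ : ∀ {n} (p : Subset n) x → ∣ p ∪ ⁅ x ⁆ ∣ ≤ suc ∣ p ∣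
∣p∪⁅x⁆∣≤suc∣p∣ p x =
  ≤-trans (∣p∪q∣≤∣p∣+∣q∣ p ⁅ x ⁆) (≤-reflexive (trans (cong (∣ p ∣ +_) (∣⁅x⁆∣≡1 x)) (+-comm ∣ p ∣ 1)))

x∈p─q⇒x∉q : ∀ {n} {x : Fin n} (p q : Subset n) → x ∈ p ─ q → x ∉ q
x∈p─q⇒x∉q (_ ∷ p) (inside ∷ q) ()          here
x∈p─q⇒x∉q (_ ∷ p) (_      ∷ q) (there x∈) (there x∈q) = x∈p─q⇒x∉q p q x∈ x∈q

∣⊥∣≤m : ∀ n {m} → ∣ ⊥ {n = n} ∣ ≤ m
∣⊥∣≤m n = ≤-trans (≤-reflexive (∣⊥∣≡0 n)) z≤n

∪-monoˡ-⊆ : ∀ {n} {p q : Subset n} r → p ⊆ q → p ∪ r ⊆ q ∪ r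
∪-monoˡ-⊆ {p = p} {q} r p⊆q x∈ = [ (λ x∈p → p⊆p∪q r (p⊆q x∈p)) , q⊆p∪q q r ] (x∈p∪q⁻ p r x∈)

x∈p⇒p∪⁅x⁆⊆p : ∀ {n} {p : Subset n} {x} → x ∈ p → p ∪ ⁅ x ⁆ ⊆ p
x∈p⇒p∪⁅x⁆⊆p {p = p} {x} x∈p y∈ =
  [ (λ y∈p → y∈p) , (λ y∈⁅x⁆ → subst (_∈ p) (sym (x∈⁅y⁆⇒x≡y x y∈⁅x⁆)) x∈p) ] (x∈p∪q⁻ p ⁅ x ⁆ y∈)

p⊆q⇒∣p─q∣≡0 : ∀ {n} {p q : Subset n} → p ⊆ q → ∣ p ─ q ∣ ≡ 0
p⊆q⇒∣p─q∣≡0 {n} {p} {q} p⊆q = n≤0⇒n≡0 (≤-trans (p⊆q⇒∣p∣≤∣q∣ p─q⊆⊥) (∣⊥∣≤m n))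
  where
  p─q⊆⊥ : p ─ q ⊆ ⊥
  p─q⊆⊥ x∈ = contradiction (p⊆q (p─q⊆p p q x∈)) (x∈p─q⇒x∉q p q x∈)

n<2m⇒⌊n/2⌋+1≤m : ∀ n m → n < 2 * m → ⌊ n /2⌋ + 1 ≤ m
n<2m⇒⌊n/2⌋+1≤m n             zero    ()
n<2m⇒⌊n/2⌋+1≤m zero          (suc m) _ = s≤s z≤n
n<2m⇒⌊n/2⌋+1≤m (suc zero)    (suc m) _ = s≤s z≤n
n<2m⇒⌊n/2⌋+1≤m (suc (suc n)) (suc m) (s≤s n+2≤2m+1) =
  s≤s (n<2m⇒⌊n/2⌋+1≤m n m (≤-pred (≤-trans n+2≤2m+1 (≤-reflexive (+-suc m (m + 0))))))

core : ∀ {n} (E : List (Subset n)) → Subset (length E) → Subset n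
core []      []            = ⊤
core (e ∷ E) (inside  ∷ T) = e ∩ core E T
core (e ∷ E) (outside ∷ T) = core E T

x∈core⁺ : ∀ {n} (E : List (Subset n)) T {x} → (∀ {i} → i ∈ T → x ∈ lookup E i) → x ∈ core E T
x∈core⁺ []      []            _ = ∈⊤
x∈core⁺ (e ∷ E) (inside  ∷ T) f = x∈p∩q⁺ (f here , x∈core⁺ E T (λ i∈T → f (there i∈T)))
x∈core⁺ (e ∷ E) (outside ∷ T) f = x∈core⁺ E T (λ i∈T → f (there i∈T))

x∈core⁻ : ∀ {n} (E : List (Subset n)) T {x i} → x ∈ core E T → i ∈ T → x ∈ lookup E i
x∈core⁻ (e ∷ E) (inside  ∷ T) x∈ here        = proj₁ (x∈p∩q⁻ e (core E T) x∈)
x∈core⁻ (e ∷ E) (inside  ∷ T) x∈ (there i∈T) = x∈core⁻ E T (proj₂ (x∈p∩q⁻ e (core E T) x∈)) i∈T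
x∈core⁻ (e ∷ E) (outside ∷ T) x∈ (there i∈T) = x∈core⁻ E T x∈ i∈T

core-⊥ : ∀ {n} (E : List (Subset n)) → core E ⊥ ≡ ⊤
core-⊥ []      = refl
core-⊥ (e ∷ E) = core-⊥ E

core-⁅⁆ : ∀ {n} (E : List (Subset n)) i → core E ⁅ i ⁆ ≡ lookup E i
core-⁅⁆ (e ∷ E) zero    = trans (cong (e ∩_) (core-⊥ E)) (∩-identityʳ e)
core-⁅⁆ (e ∷ E) (suc i) = core-⁅⁆ E i

core-antimono : ∀ {n} (E : List (Subset n)) {T U} → T ⊆ U → core E U ⊆ core E T
core-antimono E {T} {U} T⊆U x∈ = x∈core⁺ E T (λ i∈T → x∈core⁻ E U x∈ (T⊆U i∈T))

core-∪⁺ : ∀ {n} (E : List (Subset n)) {T U x} → x ∈ core E T → x ∈ core E U → x ∈ core E (T ∪ U)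
core-∪⁺ E {T} {U} x∈CT x∈CU =
  x∈core⁺ E (T ∪ U) (λ i∈ → [ x∈core⁻ E T x∈CT , x∈core⁻ E U x∈CU ] (x∈p∪q⁻ T U i∈))

step-size : ∀ {n c} {S T S' : Subset n} → ∣ S ∣ ≤ c → Step c S T S' → ∣ S' ∣ ≤ c
step-size         ∣S∣≤c pass                = ∣S∣≤c
step-size {S = S} _     (place v ∣S∣<c _ _) = ≤-trans (∣p∪⁅x⁆∣≤suc∣p∣ S v) ∣S∣<c
step-size {S = S} ∣S∣≤c (move u v u∈S _ _)  =
  ≤-trans (∣p∪⁅x⁆∣≤suc∣p∣ (S - u) v) (≤-trans (x∈p⇒∣p-x∣<∣p∣ {p = S} u∈S) ∣S∣≤c)

step-⊆ : ∀ {n c} {S T S' : Subset n} → Step c S T S' → S' ⊆ S ⊎ ∃[ v ] v ∉ T × S' ⊆ S ∪ ⁅ v ⁆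
step-⊆         pass               = inj₁ (λ x∈ → x∈)
step-⊆         (place v _ _ v∉T)  = inj₂ (v , v∉T , λ x∈ → x∈)
step-⊆ {S = S} (move u v _ _ v∉T) = inj₂ (v , v∉T , ∪-monoˡ-⊆ ⁅ v ⁆ (p─q⊆p S ⁅ u ⁆))

breaker-occupies : ∀ {n a} {M B : Subset n} {v} → v ∉ M → v ∉ B →
  ∃[ B' ] Move a 1 (st M B false) (st M B' true) × v ∈ B'
breaker-occupies {n} {B = B} {v} v∉M v∉B with nonempty? B
... | yes (u , u∈B) = (B - u) ∪ ⁅ v ⁆ , breakerMove (move u v u∈B v∉B v∉M) , q⊆p∪q _ ⁅ v ⁆ (x∈⁅x⁆ v)
... | no ¬nonempty  = B ∪ ⁅ v ⁆ , breakerMove (place v ∣B∣<1 v∉B v∉M) , q⊆p∪q B ⁅ v ⁆ (x∈⁅x⁆ v)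
  where
  ∣B∣<1 : ∣ B ∣ < 1
  ∣B∣<1 = s≤s (≤-reflexive (trans (cong ∣_∣ (Empty-unique ¬nonempty)) (∣⊥∣≡0 n)))

module _ {n : ℕ} (E : List (Subset n)) where

  private
    C = core E

  -- Here c is Maker's number of tokens plus two: a join records two threats at distinct vertices,
  -- whose cores lie in Maker's position extended by those two vertices.
  data Admissible (c : ℕ) : Subset (length E) → Set where
    edge : ∀ i → Admissible c ⁅ i ⁆
    join : ∀ {F G} → Admissible c F → Admissible c G → ∣ C F ∪ C G ∣ ≤ c → Admissible c (F ∪ G)

  admissible⇒nonempty : ∀ {c F} → Admissible c F → Nonempty F
  admissible⇒nonempty (edge i)     = i , x∈⁅x⁆ i
  admissible⇒nonempty (join {G = G} adm _ _) with admissible⇒nonempty adm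
  ... | i , i∈F = i , p⊆p∪q G i∈F

  -- As C (T ∪ F) = C T ∩ C F, this says: adjoining the edges of F to a family T that meets F
  -- shrinks the core by at most two vertices per new edge.
  ShrinkBound : Subset (length E) → Set
  ShrinkBound F = ∀ T → Nonempty (F ∩ T) → ∣ C T ─ C F ∣ ≤ 2 * ∣ F ─ T ∣

  shrinkBound⇒weight : ∀ {k F} → (∀ i → k ≤ ∣ lookup E i ∣) → Nonempty F → ShrinkBound F →
    2 + k ≤ ∣ C F ∣ + 2 * ∣ F ∣
  shrinkBound⇒weight {k} {F} large (i , i∈F) shrink = begin
    2 + k                           ≤⟨ +-monoʳ-≤ 2 (large i) ⟩
    2 + ∣ e ∣                       ≤⟨ +-monoʳ-≤ 2 (∣p∣≤∣p∪q∣ e (C F)) ⟩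
    2 + ∣ e ∪ C F ∣                 ≡⟨ cong (2 +_) (∣p─q∣+∣q∣≡∣p∪q∣ e (C F)) ⟨
    2 + (∣ e ─ C F ∣ + ∣ C F ∣)     ≤⟨ +-monoʳ-≤ 2 (+-monoˡ-≤ ∣ C F ∣ e-shrink) ⟩
    2 + (2 * ∣ F - i ∣ + ∣ C F ∣)   ≡⟨ rearrange ∣ F - i ∣ ∣ C F ∣ ⟩
    ∣ C F ∣ + 2 * suc ∣ F - i ∣     ≤⟨ +-monoʳ-≤ ∣ C F ∣ (*-monoʳ-≤ 2 (x∈p⇒∣p-x∣<∣p∣ {p = F} i∈F)) ⟩
    ∣ C F ∣ + 2 * ∣ F ∣             ∎
    where
    open ≤-Reasoning
    e = lookup E i
    e-shrink : ∣ e ─ C F ∣ ≤ 2 * ∣ F - i ∣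
    e-shrink = subst (λ s → ∣ s ─ C F ∣ ≤ 2 * ∣ F - i ∣) (core-⁅⁆ E i)
                 (shrink ⁅ i ⁆ (i , x∈p∩q⁺ (i∈F , x∈⁅x⁆ i)))
    rearrange : ∀ y c → 2 + (2 * y + c) ≡ c + 2 * suc y
    rearrange = solve-∀

  -- Adjoin F₁ to T first, then F₂ to U = T ∪ F₁.
  shrinkBound-∪ : ∀ {k F₁ F₂} T → ShrinkBound F₁ → ShrinkBound F₂ →
    2 + k ≤ ∣ C F₂ ∣ + 2 * ∣ F₂ ∣ → ∣ C F₁ ∪ C F₂ ∣ ≤ 2 + k → Nonempty (F₁ ∩ T) →
    ∣ C T ─ C (F₁ ∪ F₂) ∣ ≤ 2 * ∣ (F₁ ∪ F₂) ─ T ∣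
  shrinkBound-∪ {k} {F₁} {F₂} T shrink₁ shrink₂ weight₂ small meets₁ = begin
    ∣ C T ─ C (F₁ ∪ F₂) ∣                  ≤⟨ p⊆q⇒∣p∣≤∣q∣ split ⟩
    ∣ (C T ─ C F₁) ∪ (C U ─ C F₂) ∣        ≤⟨ ∣p∪q∣≤∣p∣+∣q∣ (C T ─ C F₁) (C U ─ C F₂) ⟩
    ∣ C T ─ C F₁ ∣ + ∣ C U ─ C F₂ ∣        ≤⟨ +-mono-≤ (shrink₁ T meets₁) shrinkU ⟩
    2 * ∣ F₁ ─ T ∣ + 2 * ∣ F₂ ─ U ∣        ≡⟨ *-distribˡ-+ 2 ∣ F₁ ─ T ∣ ∣ F₂ ─ U ∣ ⟨
    2 * (∣ F₁ ─ T ∣ + ∣ F₂ ─ U ∣)          ≡⟨ cong (2 *_) (∣p─r∣+∣q─r∪p∣≡∣p∪q─r∣ F₁ F₂ T) ⟩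
    2 * ∣ (F₁ ∪ F₂) ─ T ∣                  ∎
    where
    open ≤-Reasoning
    U = T ∪ F₁

    split : C T ─ C (F₁ ∪ F₂) ⊆ (C T ─ C F₁) ∪ (C U ─ C F₂)
    split {x} x∈ with p─q⊆p (C T) _ x∈ | x ∈? C F₁
    ... | x∈CT | no x∉CF₁  = p⊆p∪q (C U ─ C F₂) (x∈p∧x∉q⇒x∈p─q x∈CT x∉CF₁)
    ... | x∈CT | yes x∈CF₁ = q⊆p∪q (C T ─ C F₁) (C U ─ C F₂) (x∈p∧x∉q⇒x∈p─q (core-∪⁺ E x∈CT x∈CF₁) x∉CF₂)
      where
      x∉CF₂ : x ∉ C F₂
      x∉CF₂ x∈CF₂ = x∈p─q⇒x∉q (C T) _ x∈ (core-∪⁺ E x∈CF₁ x∈CF₂)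

    -- If F₂ misses U, the weight of F₂ and the join condition bound the loss by 2 |F₂| directly.
    shrinkU : ∣ C U ─ C F₂ ∣ ≤ 2 * ∣ F₂ ─ U ∣
    shrinkU with nonempty? (F₂ ∩ U)
    ... | yes meets₂ = shrink₂ U meets₂
    ... | no ¬meets₂ = ≤-trans (+-cancelʳ-≤ ∣ C F₂ ∣ _ _ counted) (*-monoʳ-≤ 2 (p⊆q⇒∣p∣≤∣q∣ F₂⊆F₂─U))
      where
      F₂⊆F₂─U : F₂ ⊆ F₂ ─ U
      F₂⊆F₂─U x∈F₂ = x∈p∧x∉q⇒x∈p─q x∈F₂ (λ x∈U → ¬meets₂ (_ , x∈p∩q⁺ (x∈F₂ , x∈U)))
      counted : ∣ C U ─ C F₂ ∣ + ∣ C F₂ ∣ ≤ 2 * ∣ F₂ ∣ + ∣ C F₂ ∣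
      counted = begin
        ∣ C U ─ C F₂ ∣ + ∣ C F₂ ∣   ≡⟨ ∣p─q∣+∣q∣≡∣p∪q∣ (C U) (C F₂) ⟩
        ∣ C U ∪ C F₂ ∣              ≤⟨ p⊆q⇒∣p∣≤∣q∣ (∪-monoˡ-⊆ (C F₂) (core-antimono E (q⊆p∪q T F₁))) ⟩
        ∣ C F₁ ∪ C F₂ ∣             ≤⟨ ≤-trans small weight₂ ⟩
        ∣ C F₂ ∣ + 2 * ∣ F₂ ∣       ≡⟨ +-comm ∣ C F₂ ∣ (2 * ∣ F₂ ∣) ⟩
        2 * ∣ F₂ ∣ + ∣ C F₂ ∣       ∎

  module _ {k : ℕ} (large : ∀ i → k ≤ ∣ lookup E i ∣) where

    admissible⇒shrinkBound : ∀ {F} → Admissible (2 + k) F → ShrinkBound F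
    admissible⇒weight : ∀ {F} → Admissible (2 + k) F → 2 + k ≤ ∣ C F ∣ + 2 * ∣ F ∣

    admissible⇒weight adm =
      shrinkBound⇒weight large (admissible⇒nonempty adm) (admissible⇒shrinkBound adm)

    admissible⇒shrinkBound (edge i) T (j , j∈⁅i⁆∩T) =
      subst (_≤ 2 * ∣ ⁅ i ⁆ ─ T ∣) (sym (p⊆q⇒∣p─q∣≡0 (core-antimono E ⁅i⁆⊆T))) z≤n
      where
      ⁅i⁆⊆T : ⁅ i ⁆ ⊆ T
      ⁅i⁆⊆T x∈⁅i⁆ with x∈p∩q⁻ ⁅ i ⁆ T j∈⁅i⁆∩T
      ... | j∈⁅i⁆ , j∈T = subst (_∈ T) (trans (x∈⁅y⁆⇒x≡y i j∈⁅i⁆) (sym (x∈⁅y⁆⇒x≡y i x∈⁅i⁆))) j∈T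
    admissible⇒shrinkBound (join {F₁} {F₂} adm₁ adm₂ small) T meets with nonempty? (F₁ ∩ T)
    ... | yes meets₁ =
      shrinkBound-∪ T (admissible⇒shrinkBound adm₁) (admissible⇒shrinkBound adm₂)
        (admissible⇒weight adm₂) small meets₁
    ... | no ¬meets₁ =
      subst (λ F → ∣ C T ─ C F ∣ ≤ 2 * ∣ F ─ T ∣) (∪-comm F₂ F₁)
        (shrinkBound-∪ T (admissible⇒shrinkBound adm₂) (admissible⇒shrinkBound adm₁)
          (admissible⇒weight adm₁) (subst (λ S → ∣ S ∣ ≤ 2 + k) (∪-comm (C F₁) (C F₂)) small) meets₂)
      where
      meets₂ : Nonempty (F₂ ∩ T)
      meets₂ with x∈p∩q⁻ (F₁ ∪ F₂) T (proj₂ meets)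
      ... | j∈F₁∪F₂ , j∈T =
        [ (λ j∈F₁ → contradiction (_ , x∈p∩q⁺ (j∈F₁ , j∈T)) ¬meets₁) , (λ j∈F₂ → _ , x∈p∩q⁺ (j∈F₂ , j∈T)) ]
          (x∈p∪q⁻ F₁ F₂ j∈F₁∪F₂)

  CoreWithin : ℕ → Subset n → Set
  CoreWithin c S = ∃[ F ] Admissible c F × C F ⊆ S

  coreWithin-mono : ∀ {c S S'} → S ⊆ S' → CoreWithin c S → CoreWithin c S'
  coreWithin-mono S⊆S' (F , adm , CF⊆S) = F , adm , λ x∈ → S⊆S' (CF⊆S x∈)

  done⇒coreWithin : ∀ {c M} → Any (λ e → e ⊆ M) E → CoreWithin c M
  done⇒coreWithin d =
    ⁅ index d ⁆ , edge (index d) , λ x∈ → lookup-index d (subst (_ ∈_) (core-⁅⁆ E (index d)) x∈)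

  coreWithin-join : ∀ {a M v₁ v₂} → ∣ M ∣ ≤ a → v₁ ≢ v₂ →
    CoreWithin (2 + a) (M ∪ ⁅ v₁ ⁆) → CoreWithin (2 + a) (M ∪ ⁅ v₂ ⁆) → CoreWithin (2 + a) M
  coreWithin-join {a} {M} {v₁} {v₂} ∣M∣≤a v₁≢v₂ (F₁ , adm₁ , CF₁⊆) (F₂ , adm₂ , CF₂⊆) =
    F₁ ∪ F₂ , join adm₁ adm₂ small , C∪⊆M
    where
    cover : C F₁ ∪ C F₂ ⊆ (M ∪ ⁅ v₁ ⁆) ∪ ⁅ v₂ ⁆
    cover x∈ with x∈p∪q⁻ (C F₁) (C F₂) x∈
    ... | inj₁ x∈CF₁ = p⊆p∪q ⁅ v₂ ⁆ (CF₁⊆ x∈CF₁)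
    ... | inj₂ x∈CF₂ =
      [ (λ x∈M → p⊆p∪q ⁅ v₂ ⁆ (p⊆p∪q ⁅ v₁ ⁆ x∈M)) , q⊆p∪q (M ∪ ⁅ v₁ ⁆) ⁅ v₂ ⁆ ] (x∈p∪q⁻ M ⁅ v₂ ⁆ (CF₂⊆ x∈CF₂))
    small : ∣ C F₁ ∪ C F₂ ∣ ≤ 2 + a
    small = begin
      ∣ C F₁ ∪ C F₂ ∣            ≤⟨ p⊆q⇒∣p∣≤∣q∣ cover ⟩
      ∣ (M ∪ ⁅ v₁ ⁆) ∪ ⁅ v₂ ⁆ ∣  ≤⟨ ∣p∪⁅x⁆∣≤suc∣p∣ (M ∪ ⁅ v₁ ⁆) v₂ ⟩
      suc ∣ M ∪ ⁅ v₁ ⁆ ∣         ≤⟨ s≤s (∣p∪⁅x⁆∣≤suc∣p∣ M v₁) ⟩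
      2 + ∣ M ∣                  ≤⟨ +-monoʳ-≤ 2 ∣M∣≤a ⟩
      2 + a                      ∎
      where open ≤-Reasoning
    C∪⊆M : C (F₁ ∪ F₂) ⊆ M
    C∪⊆M x∈ with x∈p∪q⁻ M ⁅ v₁ ⁆ (CF₁⊆ (core-antimono E (p⊆p∪q F₂) x∈))
               | x∈p∪q⁻ M ⁅ v₂ ⁆ (CF₂⊆ (core-antimono E (q⊆p∪q F₁ F₂) x∈))
    ... | inj₁ x∈M | _        = x∈M
    ... | inj₂ _   | inj₁ x∈M = x∈M
    ... | inj₂ x∈⁅v₁⁆ | inj₂ x∈⁅v₂⁆ =
      contradiction (trans (sym (x∈⁅y⁆⇒x≡y v₁ x∈⁅v₁⁆)) (x∈⁅y⁆⇒x≡y v₂ x∈⁅v₂⁆)) v₁≢v₂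

  OneMoveAway : ℕ → Subset n → Subset n → Set
  OneMoveAway c M B = CoreWithin c M ⊎ ∃[ v ] v ∉ B × CoreWithin c (M ∪ ⁅ v ⁆)

  step⇒oneMoveAway : ∀ {a c M B M'} → Step a M B M' → CoreWithin c M' → OneMoveAway c M B
  step⇒oneMoveAway step within with step-⊆ step
  ... | inj₁ M'⊆M               = inj₁ (coreWithin-mono M'⊆M within)
  ... | inj₂ (v , v∉B , M'⊆M∪v) = inj₂ (v , v∉B , coreWithin-mono M'⊆M∪v within)

  makerToMove⇒oneMoveAway : ∀ {a h M B} → ∣ M ∣ ≤ a →
    MakerWinsFrom a 1 E h (st M B true) → OneMoveAway (2 + a) M B
  breakerToMove⇒coreWithin : ∀ {a h M B} → ∣ M ∣ ≤ a →
    MakerWinsFrom a 1 E h (st M B false) → CoreWithin (2 + a) M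

  makerToMove⇒oneMoveAway _     (done d) = inj₁ (done⇒coreWithin d)
  makerToMove⇒oneMoveAway ∣M∣≤a (makerTurn _ _ (makerMove step) _ win) =
    step⇒oneMoveAway step (breakerToMove⇒coreWithin (step-size ∣M∣≤a step) win)

  -- Breaker first passes; if Maker then threatens to complete a core at v₁, Breaker occupies
  -- v₁ instead, and the second threat (necessarily at some v₂ ≠ v₁) is joined with the first.
  breakerToMove⇒coreWithin _ (done d) = done⇒coreWithin d
  breakerToMove⇒coreWithin {M = M} ∣M∣≤a (breakerTurn _ reply)
    with makerToMove⇒oneMoveAway ∣M∣≤a (proj₂ (reply _ (breakerMove pass)))
  ... | inj₁ within = within
  ... | inj₂ (v₁ , v₁∉B , within₁) with v₁ ∈? M
  ...   | yes v₁∈M = coreWithin-mono (x∈p⇒p∪⁅x⁆⊆p v₁∈M) within₁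
  ...   | no v₁∉M with breaker-occupies v₁∉M v₁∉B
  ...     | B' , occupy , v₁∈B' with makerToMove⇒oneMoveAway ∣M∣≤a (proj₂ (reply _ occupy))
  ...       | inj₁ within = within
  ...       | inj₂ (v₂ , v₂∉B' , within₂) =
    coreWithin-join ∣M∣≤a (λ v₁≡v₂ → v₂∉B' (subst (_∈ B') v₁≡v₂ v₁∈B')) within₁ within₂

  makerWins⇒smallCore : ∀ {a} → MakerWins a 1 E → ∃[ F ] Admissible (2 + a) F × ∣ C F ∣ ≤ 1
  makerWins⇒smallCore win with makerToMove⇒oneMoveAway (∣⊥∣≤m n) win
  ... | inj₁ (F , adm , CF⊆⊥)          = F , adm , ≤-trans (p⊆q⇒∣p∣≤∣q∣ CF⊆⊥) (∣⊥∣≤m n)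
  ... | inj₂ (v , _ , F , adm , CF⊆⊥∪v) =
    F , adm , ≤-trans (p⊆q⇒∣p∣≤∣q∣ CF⊆⊥∪v) (≤-trans (∣p∪⁅x⁆∣≤suc∣p∣ ⊥ v) (s≤s (∣⊥∣≤m n)))

proposition3p4 : (k n : ℕ) (E : List (Subset n)) → 1 ≤ k →
    Unique E → Uniform k E → MakerWins k 1 E →
    ⌊ k /2⌋ + 1 ≤ length E
proposition3p4 k n E _ _ uniform win with makerWins⇒smallCore E win
... | F , adm , ∣CF∣≤1 = ≤-trans (n<2m⇒⌊n/2⌋+1≤m k ∣ F ∣ k<2∣F∣) (∣p∣≤n F)
  where
  large : ∀ i → k ≤ ∣ lookup E i ∣
  large i = ≤-reflexive (sym (uniform _ (∈-lookup i)))
  k<2∣F∣ : k < 2 * ∣ F ∣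
  k<2∣F∣ = ≤-pred (≤-trans (admissible⇒weight E large adm) (+-monoˡ-≤ (2 * ∣ F ∣) ∣CF∣≤1))
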